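{- The map $\mathrm{shift}$ restricts to bijections (1) from the set of feasible partitions of $[n]$ onto the set of 2-regular partitions $\Lambda$ of $[n+1]$ such that $1+\max B\neq\min B'$ for all blocks $B,B'\in\Lambda$; (2) from the set of poor noncrossing partitions of $[n]$ onto the set of 2-regular noncrossing partitions of $[n+1]$.
   Context: For a set partition $\Lambda$ of a finite set of integers, $(i,j)$ with $i<j$ is an arc if $i,j$ share a block and $j$ is the least element of that block greater than $i$; $\mathrm{Arc}(\Lambda)$ is the set of arcs (it determines $\Lambda$ given the ground set). $[n]=\{1,\dots,n\}$. For a partition $\Lambda$ of $[n]$, $\mathrm{shift}(\Lambda)$ is the partition of $[n+1]$ with arc set $\{(i,j+1):(i,j)\in\mathrm{Arc}(\Lambda)\}$. A partition is feasible if every block has at least two elements, poor if every block has at most two elements, 2-regular if no block contains two consecutive integers $i,i+1$, and noncrossing if no arcs $(i,k),(j,l)$ satisfy $i<j<k<l$. -}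

module Defs where

open import Data.Nat using (ℕ; suc)
open import Data.Fin using (Fin; toℕ; _<_; _≤_)
open import Data.Bool using (Bool; T)
open import Data.Product using (_×_; ∃; ∃₂)
open import Data.Sum using (_⊎_)
open import Data.Empty using (⊥)
open import Relation.Nullary using (¬_)
open import Relation.Binary.PropositionalEquality using (_≡_; _≢_)
open import Function.Bundles using (_⇔_)

-- Convention: the ground set [n] = {1,…,n} is represented by Fin n,
-- the element i : Fin n standing for the integer toℕ i + 1.
-- The order on Fin n agrees with the order on integers, and
-- "j = i + 1" is expressed as toℕ j ≡ suc (toℕ i).

record Partition (n : ℕ) : Set where
  field
    rel       : Fin n → Fin n → Bool
    rel-refl  : ∀ i → T (rel i i)
    rel-sym   : ∀ {i j} → T (rel i j) → T (rel j i)
    rel-trans : ∀ {i j k} → T (rel i j) → T (rel j k) → T (rel i k)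

open Partition public

SameBlock : ∀ {n} → Partition n → Fin n → Fin n → Set
SameBlock Λ i j = T (rel Λ i j)

_≈P_ : ∀ {n} → Partition n → Partition n → Set
Λ ≈P Λ' = ∀ i j → rel Λ i j ≡ rel Λ' i j

Arc : ∀ {n} → Partition n → Fin n → Fin n → Set
Arc Λ i j = i < j × SameBlock Λ i j × (∀ k → i < k → k < j → ¬ SameBlock Λ i k)

IsShift : ∀ {n} → Partition n → Partition (suc n) → Set
IsShift Λ Λ' = ∀ a b → Arc Λ' a b ⇔
  (∃₂ λ i j → Arc Λ i j × toℕ a ≡ toℕ i × toℕ b ≡ suc (toℕ j))

Feasible : ∀ {n} → Partition n → Set
Feasible Λ = ∀ i → ∃ λ j → j ≢ i × SameBlock Λ i j

Poor : ∀ {n} → Partition n → Set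
Poor Λ = ∀ i j k → SameBlock Λ i j → SameBlock Λ i k → i ≡ j ⊎ i ≡ k ⊎ j ≡ k

TwoRegular : ∀ {n} → Partition n → Set
TwoRegular Λ = ∀ i j → toℕ j ≡ suc (toℕ i) → ¬ SameBlock Λ i j

NonCrossing : ∀ {n} → Partition n → Set
NonCrossing Λ = ∀ i j k l → Arc Λ i k → Arc Λ j l → i < j → j < k → k < l → ⊥

IsMaxOfBlock : ∀ {n} → Partition n → Fin n → Set
IsMaxOfBlock Λ i = ∀ k → SameBlock Λ i k → k ≤ i

IsMinOfBlock : ∀ {n} → Partition n → Fin n → Set
IsMinOfBlock Λ j = ∀ k → SameBlock Λ j k → j ≤ k

MaxMinNonAdjacent : ∀ {n} → Partition n → Set
MaxMinNonAdjacent Λ = ∀ i j → IsMaxOfBlock Λ i → IsMinOfBlock Λ j → toℕ j ≢ suc (toℕ i)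

record ShiftBijection (n : ℕ) (P : Partition n → Set) (Q : Partition (suc n) → Set) : Set where
  field
    defined    : ∀ Λ → P Λ → ∃ λ Λ' → IsShift Λ Λ'
    maps-into  : ∀ Λ Λ' → P Λ → IsShift Λ Λ' → Q Λ'
    injective  : ∀ Λ₁ Λ₂ Λ₁' Λ₂' → P Λ₁ → P Λ₂ → IsShift Λ₁ Λ₁' → IsShift Λ₂ Λ₂' →
                 Λ₁' ≈P Λ₂' → Λ₁ ≈P Λ₂
    surjective : ∀ Λ' → Q Λ' → ∃ λ Λ → P Λ × IsShift Λ Λ'

module Submission where

-- The proof works entirely with arc sets.
--  * Basic facts about arcs: each element has at most one incoming and one
--    outgoing arc, the arc into b comes from the largest smaller element of
--    b's block, and Poor means exactly "no two consecutive arcs".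
--  * A partition is determined by its arcs; this gives injectivity of shift.
--  * Conversely, every relation R with a < b, at most one R-source and one
--    R-target per element and decidable sources is the arc set of a
--    partition (blocks = chains of R, found by following sources to a root).
--    Applied to the shifted arcs this constructs shift(Λ); applied to the
--    "unshifted" arcs of a 2-regular Λ' it constructs the preimage of Λ'.
--  * Each property transfers along shift in the required direction, and the
--    theorem assembles the two bijections from these transfers.

open import Defs
open import Data.Nat as ℕ using (ℕ; zero; suc; z≤n; s≤s)
import Data.Nat.Properties as ℕₚ
open import Data.Fin as F using (Fin; toℕ; inject₁; lower₁; _<_; _≤_)
open import Data.Fin.Properties
  using (toℕ-injective; toℕ-inject₁; inject₁-injective; inject₁-lower₁; suc-injective;
         toℕ<n; <-cmp; _<?_; <⇒≢; ≤-antisym; ≤̄⇒inject₁<)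
open import Data.Fin.Induction using (<-wellFounded)
open import Data.Bool using (Bool; true; T)
open import Data.Bool.Properties using (T-≡; ⇔→≡)
open import Data.Product using (_×_; _,_; proj₁; proj₂; ∃; ∃₂)
open import Data.Sum using (_⊎_; inj₁; inj₂; [_,_])
open import Data.Empty using (⊥; ⊥-elim)
open import Function using (_∘_)
open import Function.Bundles using (_⇔_; mk⇔; Equivalence)
open import Induction.WellFounded using (Acc; acc)
open import Relation.Binary.Definitions using (tri<; tri≈; tri>)
open import Relation.Binary.PropositionalEquality using (_≡_; _≢_; refl; sym; trans; cong; subst; subst₂)
open import Relation.Nullary using (¬_; yes; no)
open import Relation.Nullary.Decidable using (_×-dec_; ⌊_⌋; toWitness; fromWitness)
open import Relation.Nullary.Decidable.Core using (T?)
open import Relation.Unary using (Decidable)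

inject₁-mono-< : ∀ {n} {i j : Fin n} → i < j → inject₁ i < inject₁ j
inject₁-mono-< {i = i} {j} = subst₂ ℕ._<_ (sym (toℕ-inject₁ i)) (sym (toℕ-inject₁ j))

inject₁-cancel-< : ∀ {n} {i j : Fin n} → inject₁ i < inject₁ j → i < j
inject₁-cancel-< {i = i} {j} = subst₂ ℕ._<_ (toℕ-inject₁ i) (toℕ-inject₁ j)

inject₁<suc⇒≤ : ∀ {n} {i j : Fin n} → inject₁ i < F.suc j → i ≤ j
inject₁<suc⇒≤ {i = i} lt = subst (ℕ._≤ _) (toℕ-inject₁ i) (ℕₚ.≤-pred lt)

below-last : ∀ {n} (a : Fin (suc n)) → toℕ a ℕ.< n → ∃ λ i → a ≡ inject₁ i
below-last a a<n = lower₁ a (ℕₚ.<⇒≢ a<n ∘ sym) , sym (inject₁-lower₁ a _)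

consecutive-pair : ∀ {n} {a b : Fin (suc n)} → toℕ b ≡ suc (toℕ a) →
                   ∃ λ i → a ≡ inject₁ i × b ≡ F.suc i
consecutive-pair {b = F.suc i} b≡a+1 =
  i , toℕ-injective (trans (sym (ℕₚ.suc-injective b≡a+1)) (sym (toℕ-inject₁ i))) , refl

largest : ∀ {n} (Q : Fin n → Set) → Decidable Q →
          (∃ λ a → Q a × (∀ a' → Q a' → a' ≤ a)) ⊎ (∀ a → ¬ Q a)
largest {zero} Q Q? = inj₂ λ ()
largest {suc n} Q Q? with largest (Q ∘ F.suc) (Q? ∘ F.suc)
... | inj₁ (a , q , max) = inj₁ (F.suc a , q , λ { F.zero _ → z≤n ; (F.suc a') q' → s≤s (max a' q') })
... | inj₂ none with Q? F.zero
...   | yes q = inj₁ (F.zero , q , λ { F.zero _ → z≤n ; (F.suc a') q' → ⊥-elim (none a' q') })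
...   | no ¬q = inj₂ λ { F.zero → ¬q ; (F.suc a) → none a }

smallest : ∀ {n} (Q : Fin n → Set) → Decidable Q →
           (∃ λ a → Q a × (∀ a' → Q a' → a ≤ a')) ⊎ (∀ a → ¬ Q a)
smallest {zero} Q Q? = inj₂ λ ()
smallest {suc n} Q Q? with Q? F.zero
... | yes q = inj₁ (F.zero , q , λ _ _ → z≤n)
... | no ¬q with smallest (Q ∘ F.suc) (Q? ∘ F.suc)
...   | inj₁ (a , q , min) =
        inj₁ (F.suc a , q , λ { F.zero q' → ⊥-elim (¬q q') ; (F.suc a') q' → s≤s (min a' q') })
...   | inj₂ none = inj₂ λ { F.zero → ¬q ; (F.suc a) → none a }

NoConsecutiveArcs : ∀ {n} → Partition n → Set
NoConsecutiveArcs Λ = ∀ {a b c} → Arc Λ a b → Arc Λ b c → ⊥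

module ArcFacts {n : ℕ} (Λ : Partition n) where

  private
    S : Fin n → Fin n → Set
    S = SameBlock Λ

    S-sym : ∀ {i j} → S i j → S j i
    S-sym = rel-sym Λ

    S-trans : ∀ {i j k} → S i j → S j k → S i k
    S-trans = rel-trans Λ

  arc-source-closest : ∀ {a b c} → Arc Λ a b → c < b → S c b → c ≤ a
  arc-source-closest (_ , sab , between) c<b scb =
    ℕₚ.≮⇒≥ λ a<c → between _ a<c c<b (S-trans sab (S-sym scb))

  arc-target-closest : ∀ {a b c} → Arc Λ a b → a < c → S a c → b ≤ c
  arc-target-closest (_ , _ , between) a<c sac = ℕₚ.≮⇒≥ λ c<b → between _ a<c c<b sac

  arc-source-unique : ∀ {a a' b} → Arc Λ a b → Arc Λ a' b → a ≡ a'
  arc-source-unique a→b@(a<b , sab , _) a'→b@(a'<b , sa'b , _) =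
    ≤-antisym (arc-source-closest a'→b a<b sab) (arc-source-closest a→b a'<b sa'b)

  arc-target-unique : ∀ {a b b'} → Arc Λ a b → Arc Λ a b' → b ≡ b'
  arc-target-unique a→b@(a<b , sab , _) a→b'@(a<b' , sab' , _) =
    ≤-antisym (arc-target-closest a→b a<b' sab') (arc-target-closest a→b' a<b sab)

  incoming : ∀ b → (∃ λ a → Arc Λ a b) ⊎ (∀ a → a < b → ¬ S a b)
  incoming b with largest (λ a → a < b × S a b) (λ a → (a <? b) ×-dec T? (rel Λ a b))
  ... | inj₁ (a , (a<b , sab) , max) =
        inj₁ (a , a<b , sab , λ k a<k k<b sak → ℕₚ.<⇒≱ a<k (max k (k<b , S-trans (S-sym sak) sab)))
  ... | inj₂ none = inj₂ λ a a<b sab → none a (a<b , sab)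

  outgoing : ∀ a → (∃ λ b → Arc Λ a b) ⊎ (∀ b → a < b → ¬ S a b)
  outgoing a with smallest (λ b → a < b × S a b) (λ b → (a <? b) ×-dec T? (rel Λ a b))
  ... | inj₁ (b , (a<b , sab) , min) =
        inj₁ (b , a<b , sab , λ k a<k k<b sak → ℕₚ.<⇒≱ k<b (min k (a<k , sak)))
  ... | inj₂ none = inj₂ λ b a<b sab → none b (a<b , sab)

  arc-into : ∀ {b c} → S c b → c < b → ∃ λ a → Arc Λ a b × c ≤ a
  arc-into {b} scb c<b with incoming b
  ... | inj₁ (a , a→b) = a , a→b , arc-source-closest a→b c<b scb
  ... | inj₂ b-least = ⊥-elim (b-least _ c<b scb)

  arc-out-of : ∀ {a c} → S a c → a < c → ∃ λ b → Arc Λ a b × b ≤ c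
  arc-out-of {a} sac a<c with outgoing a
  ... | inj₁ (b , a→b) = b , a→b , arc-target-closest a→b a<c sac
  ... | inj₂ a-largest = ⊥-elim (a-largest _ a<c sac)

  no-outgoing⇒max : ∀ {a} → (∀ b → ¬ Arc Λ a b) → IsMaxOfBlock Λ a
  no-outgoing⇒max none k sak = ℕₚ.≮⇒≥ λ a<k → none _ (proj₁ (proj₂ (arc-out-of sak a<k)))

  no-incoming⇒min : ∀ {b} → (∀ a → ¬ Arc Λ a b) → IsMinOfBlock Λ b
  no-incoming⇒min none k sbk = ℕₚ.≮⇒≥ λ k<b → none _ (proj₁ (proj₂ (arc-into (S-sym sbk) k<b)))

  consecutive-arc : ∀ {i j} → toℕ j ≡ suc (toℕ i) → S i j → Arc Λ i j
  consecutive-arc {i} {j} j≡i+1 sij =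
    subst (toℕ i ℕ.<_) (sym j≡i+1) (ℕₚ.n<1+n _) , sij ,
    λ k i<k k<j _ → ℕₚ.<⇒≱ k<j (subst (ℕ._≤ toℕ k) (sym j≡i+1) i<k)

  two-regular-arc-gap : TwoRegular Λ → ∀ {a b} → Arc Λ a b → suc (toℕ a) ℕ.< toℕ b
  two-regular-arc-gap two-regular {a} {b} (a<b , sab , _) =
    ℕₚ.≤∧≢⇒< a<b λ b≡a+1 → two-regular a b (sym b≡a+1) sab

  three-in-block⇒consecutive-arcs : ∀ {x y z} → x < y → y < z → S x y → S y z →
                                     ∃₂ λ b c → Arc Λ x b × Arc Λ b c
  three-in-block⇒consecutive-arcs x<y y<z sxy syz with arc-out-of sxy x<y
  ... | b , x→b@(_ , sxb , _) , b≤y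
      with arc-out-of (S-trans (S-sym sxb) (S-trans sxy syz)) (ℕₚ.≤-<-trans b≤y y<z)
  ...   | c , b→c , _ = b , c , x→b , b→c

  no-three : NoConsecutiveArcs Λ → ∀ {x y z} → x < y → y < z → S x y → S y z → ⊥
  no-three no-path x<y y<z sxy syz with three-in-block⇒consecutive-arcs x<y y<z sxy syz
  ... | _ , _ , x→b , b→c = no-path x→b b→c

  poor⇒no-consecutive-arcs : Poor Λ → NoConsecutiveArcs Λ
  poor⇒no-consecutive-arcs poor (a<b , sab , _) (b<c , sbc , _) with poor _ _ _ (S-sym sab) sbc
  ... | inj₁ refl = ℕₚ.<-irrefl refl a<b
  ... | inj₂ (inj₁ refl) = ℕₚ.<-irrefl refl b<c
  ... | inj₂ (inj₂ refl) = ℕₚ.<-asym a<b b<c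

  block-pair : NoConsecutiveArcs Λ → ∀ {x y z} → x < y → S x y → S x z → z ≡ x ⊎ z ≡ y
  block-pair no-path {x} {y} {z} x<y sxy sxz with <-cmp z x | <-cmp z y
  ... | tri≈ _ z≡x _ | _ = inj₁ z≡x
  ... | _ | tri≈ _ z≡y _ = inj₂ z≡y
  ... | tri< z<x _ _ | _ = ⊥-elim (no-three no-path z<x x<y (S-sym sxz) sxy)
  ... | tri> _ _ x<z | tri< z<y _ _ = ⊥-elim (no-three no-path x<z z<y sxz (S-trans (S-sym sxz) sxy))
  ... | tri> _ _ x<z | tri> _ _ y<z = ⊥-elim (no-three no-path x<y y<z sxy (S-trans (S-sym sxy) sxz))

  no-consecutive-arcs⇒poor : NoConsecutiveArcs Λ → Poor Λ
  no-consecutive-arcs⇒poor no-path i j k sij sik with <-cmp i j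
  ... | tri≈ _ i≡j _ = inj₁ i≡j
  ... | tri< i<j _ _ = [ (λ k≡i → inj₂ (inj₁ (sym k≡i))) , (λ k≡j → inj₂ (inj₂ (sym k≡j))) ]
                         (block-pair no-path i<j sij sik)
  ... | tri> _ _ j<i = [ (λ k≡j → inj₂ (inj₂ (sym k≡j))) , (λ k≡i → inj₂ (inj₁ (sym k≡i))) ]
                         (block-pair no-path j<i (S-sym sij) (S-trans (S-sym sij) sik))

module ArcsDetermineBlocks {n : ℕ} {Λ₁ Λ₂ : Partition n}
  (arcs⊆ : ∀ {a b} → Arc Λ₁ a b → Arc Λ₂ a b) where

  open ArcFacts Λ₁ using (arc-into)

  -- Induction on the upper element y: follow the arc of Λ₁ entering y.
  upward : ∀ {x} y → Acc _<_ y → x < y → SameBlock Λ₁ x y → SameBlock Λ₂ x y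
  upward {x} y (acc smaller) x<y sxy with arc-into sxy x<y
  ... | k , k→y@(k<y , sky , _) , x≤k with <-cmp x k
  ...   | tri≈ _ refl _ = proj₁ (proj₂ (arcs⊆ k→y))
  ...   | tri< x<k _ _ = rel-trans Λ₂ (upward k (smaller k<y) x<k (rel-trans Λ₁ sxy (rel-sym Λ₁ sky)))
                                      (proj₁ (proj₂ (arcs⊆ k→y)))
  ...   | tri> _ _ k<x = ⊥-elim (ℕₚ.<⇒≱ k<x x≤k)

  blocks⊆ : ∀ {i j} → SameBlock Λ₁ i j → SameBlock Λ₂ i j
  blocks⊆ {i} {j} sij with <-cmp i j
  ... | tri≈ _ refl _ = rel-refl Λ₂ i
  ... | tri< i<j _ _ = upward j (<-wellFounded j) i<j sij
  ... | tri> _ _ j<i = rel-sym Λ₂ (upward i (<-wellFounded i) j<i (rel-sym Λ₁ sij))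

T-extensional : ∀ {x y : Bool} → (T x → T y) → (T y → T x) → x ≡ y
T-extensional {x} {y} x⇒y y⇒x =
  ⇔→≡ {z = true} (mk⇔ (Equivalence.to (T-≡ {y}) ∘ x⇒y ∘ Equivalence.from (T-≡ {x}))
                      (Equivalence.to (T-≡ {x}) ∘ y⇒x ∘ Equivalence.from (T-≡ {y})))

arcs-determine : ∀ {n} {Λ₁ Λ₂ : Partition n} →
                 (∀ {a b} → Arc Λ₁ a b → Arc Λ₂ a b) → (∀ {a b} → Arc Λ₂ a b → Arc Λ₁ a b) → Λ₁ ≈P Λ₂
arcs-determine {Λ₁ = Λ₁} {Λ₂} arcs₁⊆₂ arcs₂⊆₁ i j =
  T-extensional (ArcsDetermineBlocks.blocks⊆ {Λ₁ = Λ₁} {Λ₂} arcs₁⊆₂)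
                (ArcsDetermineBlocks.blocks⊆ {Λ₁ = Λ₂} {Λ₁} arcs₂⊆₁)

≈P⇒arc : ∀ {n} {Λ Λ' : Partition n} → Λ ≈P Λ' → ∀ {a b} → Arc Λ a b → Arc Λ' a b
≈P⇒arc eq {a} {b} (a<b , sab , between) =
  a<b , subst T (eq a b) sab , λ k a<k k<b sak → between k a<k k<b (subst T (sym (eq a k)) sak)

-- Its blocks are the R-chains; the
-- block of i is identified by its root, reached by following sources downwards.
module PrescribedArcs {m : ℕ} (R : Fin m → Fin m → Set)
  (R⇒< : ∀ {a b} → R a b → a < b)
  (source-unique : ∀ {a a' b} → R a b → R a' b → a ≡ a')
  (target-unique : ∀ {a b b'} → R a b → R a b' → b ≡ b')
  (source? : ∀ b → (∃ λ a → R a b) ⊎ (∀ a → ¬ R a b)) where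

  data Ancestor (z : Fin m) : Fin m → Set where
    here : Ancestor z z
    back : ∀ {x y} → R y x → Ancestor z y → Ancestor z x

  ancestor-≤ : ∀ {z x} → Ancestor z x → z ≤ x
  ancestor-≤ here = ℕₚ.≤-refl
  ancestor-≤ (back r anc) = ℕₚ.≤-trans (ancestor-≤ anc) (ℕₚ.<⇒≤ (R⇒< r))

  ancestor-first-step : ∀ {z x} → Ancestor z x → z ≢ x → ∃ λ x' → R z x' × Ancestor x' x
  ancestor-first-step here z≢x = ⊥-elim (z≢x refl)
  ancestor-first-step {z} (back {y = y} r anc) z≢x with z F.≟ y
  ... | yes refl = _ , r , here
  ... | no z≢y with ancestor-first-step anc z≢y
  ...   | x' , r' , anc' = x' , r' , back r anc'

  rootAcc : (i : Fin m) → Acc _<_ i → Fin m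
  rootAcc i (acc smaller) with source? i
  ... | inj₁ (a , r) = rootAcc a (smaller (R⇒< r))
  ... | inj₂ _ = i

  rootAcc-irrelevant : ∀ i (p q : Acc _<_ i) → rootAcc i p ≡ rootAcc i q
  rootAcc-irrelevant i (acc p) (acc q) with source? i
  ... | inj₁ (a , r) = rootAcc-irrelevant a (p (R⇒< r)) (q (R⇒< r))
  ... | inj₂ _ = refl

  rootAcc-ancestor : ∀ i (p : Acc _<_ i) → Ancestor (rootAcc i p) i
  rootAcc-ancestor i (acc p) with source? i
  ... | inj₁ (a , r) = back r (rootAcc-ancestor a (p (R⇒< r)))
  ... | inj₂ _ = here

  rootAcc-initial : ∀ {i} (p : Acc _<_ i) → (∀ a → ¬ R a i) → rootAcc i p ≡ i
  rootAcc-initial {i} (acc p) none with source? i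
  ... | inj₁ (a , r) = ⊥-elim (none a r)
  ... | inj₂ _ = refl

  rootAcc-step : ∀ {a i} (p : Acc _<_ i) (q : Acc _<_ a) → R a i → rootAcc i p ≡ rootAcc a q
  rootAcc-step {a} {i} (acc p) q r with source? i
  ... | inj₂ none = ⊥-elim (none a r)
  ... | inj₁ (a' , r') with source-unique r' r
  ...   | refl = rootAcc-irrelevant a (p (R⇒< r')) q

  -- root is kept abstract so that case splits on source? never unfold it
  abstract
    root : Fin m → Fin m
    root i = rootAcc i (<-wellFounded i)

    root≤ : ∀ i → root i ≤ i
    root≤ i = ancestor-≤ (rootAcc-ancestor i (<-wellFounded i))

    root-initial : ∀ {i} → (∀ a → ¬ R a i) → root i ≡ i
    root-initial = rootAcc-initial (<-wellFounded _)

    root-step : ∀ {a i} → R a i → root i ≡ root a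
    root-step = rootAcc-step (<-wellFounded _) (<-wellFounded _)

  same-root⇒ancestor : ∀ {x} y → Acc _<_ y → root x ≡ root y → x < y → Ancestor x y
  same-root⇒ancestor {x} y (acc smaller) rx≡ry x<y with source? y
  ... | inj₂ none = ⊥-elim (ℕₚ.<⇒≱ x<y (subst (_≤ x) (trans rx≡ry (root-initial none)) (root≤ x)))
  ... | inj₁ (y' , r) with <-cmp x y'
  ...   | tri< x<y' _ _ = back r (same-root⇒ancestor y' (smaller (R⇒< r)) (trans rx≡ry (root-step r)) x<y')
  ...   | tri≈ _ refl _ = back r here
  -- if y' < x, the chain from y' up to x leaves y' towards y (unique target), forcing y ≤ x
  ...   | tri> _ _ y'<x
        with same-root⇒ancestor x (smaller x<y) (sym (trans rx≡ry (root-step r))) y'<x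
  ...     | y'↝x with ancestor-first-step y'↝x (<⇒≢ y'<x)
  ...       | x' , r' , anc = ⊥-elim (ℕₚ.<⇒≱ x<y (subst (_≤ x) (target-unique r' r) (ancestor-≤ anc)))

  no-element-between : ∀ {a b k} → R a b → a < k → k < b → root a ≢ root k
  no-element-between {a} {b} {k} r a<k k<b ra≡rk
    with same-root⇒ancestor b (<-wellFounded b) (trans (sym ra≡rk) (sym (root-step r))) k<b
  ... | here = ℕₚ.<-irrefl refl k<b
  ... | back r' anc with source-unique r' r
  ...   | refl = ℕₚ.<⇒≱ a<k (ancestor-≤ anc)

  partition : Partition m
  partition = record
    { rel       = λ i j → ⌊ root i F.≟ root j ⌋
    ; rel-refl  = λ i → fromWitness refl
    ; rel-sym   = λ {i} {j} sij → fromWitness (sym (toWitness sij))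
    ; rel-trans = λ {i} {j} {k} sij sjk → fromWitness (trans (toWitness sij) (toWitness sjk))
    }

  R⇒arc : ∀ {a b} → R a b → Arc partition a b
  R⇒arc r = R⇒< r , fromWitness (sym (root-step r)) ,
            λ k a<k k<b sak → no-element-between r a<k k<b (toWitness sak)

  arc⇒R : ∀ {a b} → Arc partition a b → R a b
  arc⇒R {a} {b} (a<b , sab , between) with source? b
  ... | inj₂ none = ⊥-elim (ℕₚ.<⇒≱ a<b (subst (_≤ a) (trans (toWitness sab) (root-initial none)) (root≤ a)))
  ... | inj₁ (c , r) with <-cmp c a
  ...   | tri≈ _ refl _ = r
  ...   | tri< c<a _ _ = ⊥-elim (no-element-between r c<a a<b (sym (trans (toWitness sab) (root-step r))))
  ...   | tri> _ _ a<c = ⊥-elim (between c a<c (R⇒< r) (fromWitness (trans (toWitness sab) (root-step r))))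

  arcs : ∀ a b → Arc partition a b ⇔ R a b
  arcs a b = mk⇔ arc⇒R R⇒arc

ShiftedArc : ∀ {n} → Partition n → Fin (suc n) → Fin (suc n) → Set
ShiftedArc Λ a b = ∃₂ λ i j → Arc Λ i j × toℕ a ≡ toℕ i × toℕ b ≡ suc (toℕ j)

shifted-arc : ∀ {n} (Λ : Partition n) {i j} → Arc Λ i j → ShiftedArc Λ (inject₁ i) (F.suc j)
shifted-arc Λ {i} {j} i→j = i , j , i→j , toℕ-inject₁ i , refl

shifted-arc-form : ∀ {n} (Λ : Partition n) {a b} → ShiftedArc Λ a b →
                   ∃₂ λ i j → Arc Λ i j × a ≡ inject₁ i × b ≡ F.suc j
shifted-arc-form Λ (i , j , i→j , a≡i , b≡j+1) =
  i , j , i→j , toℕ-injective (trans a≡i (sym (toℕ-inject₁ i))) , toℕ-injective b≡j+1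

shift-intro : ∀ {n} (Λ : Partition n) (Λ' : Partition (suc n)) →
              (∀ {i j} → Arc Λ i j → Arc Λ' (inject₁ i) (F.suc j)) →
              (∀ {a b} → Arc Λ' a b → ∃₂ λ i j → Arc Λ i j × a ≡ inject₁ i × b ≡ F.suc j) →
              IsShift Λ Λ'
shift-intro Λ Λ' up down a b = mk⇔ to from
  where
  to : Arc Λ' a b → ShiftedArc Λ a b
  to a→b with down a→b
  ... | i , j , i→j , refl , refl = shifted-arc Λ i→j
  from : ShiftedArc Λ a b → Arc Λ' a b
  from s with shifted-arc-form Λ s
  ... | i , j , i→j , refl , refl = up i→j

module Shift {n : ℕ} (Λ : Partition n) where
  open ArcFacts Λ

  shifted-source-unique : ∀ {a a' b} → ShiftedArc Λ a b → ShiftedArc Λ a' b → a ≡ a'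
  shifted-source-unique s s' with shifted-arc-form Λ s | shifted-arc-form Λ s'
  ... | i , j , i→j , refl , refl | i' , .j , i'→j , refl , refl =
        cong inject₁ (arc-source-unique i→j i'→j)

  shifted-target-unique : ∀ {a b b'} → ShiftedArc Λ a b → ShiftedArc Λ a b' → b ≡ b'
  shifted-target-unique s s' with shifted-arc-form Λ s | shifted-arc-form Λ s'
  ... | i , j , i→j , refl , refl | i' , j' , i'→j' , a≡i' , refl
      with inject₁-injective a≡i'
  ...   | refl = cong F.suc (arc-target-unique i→j i'→j')

  shifted-source? : ∀ b → (∃ λ a → ShiftedArc Λ a b) ⊎ (∀ a → ¬ ShiftedArc Λ a b)
  shifted-source? F.zero = inj₂ λ { a (_ , _ , _ , _ , ()) }
  shifted-source? (F.suc j) with incoming j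
  ... | inj₁ (i , i→j) = inj₁ (inject₁ i , shifted-arc Λ i→j)
  ... | inj₂ j-least = inj₂ λ _ → no-shifted-source
    where
    no-shifted-source : ∀ {a} → ShiftedArc Λ a (F.suc j) → ⊥
    no-shifted-source s with shifted-arc-form Λ s
    ... | i , .j , (i<j , sij , _) , _ , refl = j-least i i<j sij

  shifted-< : ∀ {a b} → ShiftedArc Λ a b → a < b
  shifted-< (i , j , (i<j , _) , a≡i , b≡j+1) = subst₂ ℕ._<_ (sym a≡i) (sym b≡j+1) (ℕₚ.m<n⇒m<1+n i<j)

  open PrescribedArcs (ShiftedArc Λ) shifted-< shifted-source-unique shifted-target-unique shifted-source?

  shift-exists : ∃ λ Λ' → IsShift Λ Λ'
  shift-exists = partition , arcs

module Unshift {n : ℕ} (Λ' : Partition (suc n)) (two-regular : TwoRegular Λ') where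
  open ArcFacts Λ'

  UnshiftedArc : Fin n → Fin n → Set
  UnshiftedArc i j = Arc Λ' (inject₁ i) (F.suc j)

  -- By 2-regularity an arc (a, b) of Λ' has a + 1 < b, so a comes from [n].
  arc-form : ∀ {a b} → Arc Λ' a b → ∃₂ λ i j → UnshiftedArc i j × a ≡ inject₁ i × b ≡ F.suc j
  arc-form {a} {F.zero} (() , _)
  arc-form {a} {F.suc j} a→b
    with below-last a (ℕₚ.<-trans (ℕₚ.≤-pred (two-regular-arc-gap two-regular a→b)) (toℕ<n j))
  ... | i , refl = i , j , a→b , refl , refl

  unshifted-< : ∀ {i j} → UnshiftedArc i j → i < j
  unshifted-< {i} i→j = subst (ℕ._< _) (toℕ-inject₁ i) (ℕₚ.≤-pred (two-regular-arc-gap two-regular i→j))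

  unshifted-source-unique : ∀ {i i' j} → UnshiftedArc i j → UnshiftedArc i' j → i ≡ i'
  unshifted-source-unique i→j i'→j = inject₁-injective (arc-source-unique i→j i'→j)

  unshifted-target-unique : ∀ {i j j'} → UnshiftedArc i j → UnshiftedArc i j' → j ≡ j'
  unshifted-target-unique i→j i→j' = suc-injective (arc-target-unique i→j i→j')

  unshifted-source? : ∀ j → (∃ λ i → UnshiftedArc i j) ⊎ (∀ i → ¬ UnshiftedArc i j)
  unshifted-source? j with incoming (F.suc j)
  ... | inj₁ (a , a→j+1) with arc-form a→j+1
  ...   | i , .j , i→j , refl , refl = inj₁ (i , i→j)
  unshifted-source? j | inj₂ least = inj₂ λ i (i<j+1 , sij , _) → least (inject₁ i) i<j+1 sij

  open PrescribedArcs UnshiftedArc unshifted-< unshifted-source-unique unshifted-target-unique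
                      unshifted-source?

  unshift-exists : ∃ λ Λ → IsShift Λ Λ'
  unshift-exists = partition , shift-intro partition Λ' arc⇒R down
    where
    down : ∀ {a b} → Arc Λ' a b → ∃₂ λ i j → Arc partition i j × a ≡ inject₁ i × b ≡ F.suc j
    down a→b with arc-form a→b
    ... | i , j , i→j , a≡i , b≡j+1 = i , j , R⇒arc i→j , a≡i , b≡j+1

module AlongShift {n : ℕ} (Λ : Partition n) (Λ' : Partition (suc n)) (sh : IsShift Λ Λ') where
  open ArcFacts Λ
  open ArcFacts Λ' using ()
    renaming (consecutive-arc to consecutive-arc'; no-outgoing⇒max to no-outgoing⇒max';
              no-incoming⇒min to no-incoming⇒min')

  shift-arc : ∀ {i j} → Arc Λ i j → Arc Λ' (inject₁ i) (F.suc j)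
  shift-arc i→j = Equivalence.from (sh _ _) (shifted-arc Λ i→j)

  unshift-arc : ∀ {a b} → Arc Λ' a b → ∃₂ λ i j → Arc Λ i j × a ≡ inject₁ i × b ≡ F.suc j
  unshift-arc a→b = shifted-arc-form Λ (Equivalence.to (sh _ _) a→b)

  -- Shifted arcs (i, j+1) with i < j never join consecutive elements.
  shift-two-regular : TwoRegular Λ'
  shift-two-regular a b b≡a+1 sab with unshift-arc (consecutive-arc' {a} {b} b≡a+1 sab)
  ... | i , j , (i<j , _) , refl , refl =
        ℕₚ.<-irrefl (trans (sym (toℕ-inject₁ i)) (sym (ℕₚ.suc-injective b≡a+1))) i<j

  -- If max B = i and min B' = i+1 in shift(Λ), then i is a singleton block of Λ.
  shift-max-min : Feasible Λ → MaxMinNonAdjacent Λ'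
  shift-max-min feasible a b a-max b-min b≡a+1 with consecutive-pair b≡a+1
  ... | i , refl , refl with feasible i
  ...   | k , k≢i , sik with <-cmp i k
  ...     | tri≈ _ i≡k _ = k≢i (sym i≡k)
  ...     | tri< i<k _ _ with arc-out-of sik i<k
  ...       | c , i→c , _ = ℕₚ.<⇒≱ (≤̄⇒inject₁< (ℕₚ.<⇒≤ (proj₁ i→c)))
                                  (a-max (F.suc c) (proj₁ (proj₂ (shift-arc {i} {c} i→c))))
  shift-max-min feasible _ _ a-max b-min _ | i , refl , refl | k , k≢i , sik | tri> _ _ k<i
    with arc-into (rel-sym Λ sik) k<i
  ... | d , d→i , _ = ℕₚ.<⇒≱ (≤̄⇒inject₁< (ℕₚ.<⇒≤ (proj₁ d→i)))
                             (b-min (inject₁ d) (rel-sym Λ' (proj₁ (proj₂ (shift-arc {d} {i} d→i)))))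

  -- A crossing in shift(Λ) comes from a crossing in Λ or from two consecutive arcs.
  shift-noncrossing : Poor Λ → NonCrossing Λ → NonCrossing Λ'
  shift-noncrossing poor noncrossing a b c d a→c b→d a<b b<c c<d
    with unshift-arc {a} {c} a→c | unshift-arc {b} {d} b→d
  ... | i , k , i→k , refl , refl | j , l , j→l , refl , refl with <-cmp j k
  ...   | tri< j<k _ _ = noncrossing i j k l i→k j→l (inject₁-cancel-< a<b) j<k (ℕₚ.≤-pred c<d)
  ...   | tri≈ _ refl _ = poor⇒no-consecutive-arcs poor i→k j→l
  ...   | tri> _ _ k<j = ℕₚ.<⇒≱ k<j (inject₁<suc⇒≤ b<c)

  unshift-noncrossing : NonCrossing Λ' → NonCrossing Λ
  unshift-noncrossing noncrossing' i j k l i→k j→l i<j j<k k<l =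
    noncrossing' _ _ _ _ (shift-arc {i} {k} i→k) (shift-arc {j} {l} j→l)
      (inject₁-mono-< i<j) (≤̄⇒inject₁< (ℕₚ.<⇒≤ j<k)) (s≤s k<l)

  -- Consecutive arcs (a, b), (b, c) of Λ shift to the crossing arcs (a, b+1), (b, c+1).
  unshift-poor : NonCrossing Λ' → Poor Λ
  unshift-poor noncrossing' = no-consecutive-arcs⇒poor λ {a} {b} {c} a→b b→c →
    noncrossing' _ _ _ _ (shift-arc {a} {b} a→b) (shift-arc {b} {c} b→c)
      (inject₁-mono-< (proj₁ a→b)) (≤̄⇒inject₁< ℕₚ.≤-refl) (s≤s (proj₁ b→c))

  -- A singleton block {i} of Λ would give max B = i, min B' = i+1 in shift(Λ).
  unshift-feasible : MaxMinNonAdjacent Λ' → Feasible Λ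
  unshift-feasible max-min i with outgoing i | incoming i
  ... | inj₁ (b , i<b , sib , _) | _ = b , (λ b≡i → <⇒≢ i<b (sym b≡i)) , sib
  ... | inj₂ _ | inj₁ (a , a<i , sai , _) = a , <⇒≢ a<i , rel-sym Λ sai
  ... | inj₂ i-largest | inj₂ i-least =
        ⊥-elim (max-min (inject₁ i) (F.suc i) (no-outgoing⇒max' no-out) (no-incoming⇒min' no-in)
                (cong suc (sym (toℕ-inject₁ i))))
    where
    no-out : ∀ b → ¬ Arc Λ' (inject₁ i) b
    no-out b i→b with unshift-arc {inject₁ i} {b} i→b
    ... | i' , j , (i'<j , si'j , _) , i≡i' , refl with inject₁-injective i≡i'
    ...   | refl = i-largest j i'<j si'j
    no-in : ∀ a → ¬ Arc Λ' a (F.suc i)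
    no-in a a→i with unshift-arc {a} {F.suc i} a→i
    ... | i' , .i , (i'<i , si'i , _) , refl , refl = i-least i' i'<i si'i

-- Shifting is injective: equal shifts have equal arcs, hence equal blocks.
shift-arcs⊆ : ∀ {n} (Λ₁ Λ₂ : Partition n) (Λ₁' Λ₂' : Partition (suc n)) →
              IsShift Λ₁ Λ₁' → IsShift Λ₂ Λ₂' → Λ₁' ≈P Λ₂' → ∀ {a b} → Arc Λ₁ a b → Arc Λ₂ a b
shift-arcs⊆ Λ₁ Λ₂ Λ₁' Λ₂' sh₁ sh₂ eq {a} {b} a→b
  with AlongShift.unshift-arc Λ₂ Λ₂' sh₂ {inject₁ a} {F.suc b}
         (≈P⇒arc {Λ = Λ₁'} {Λ₂'} eq (AlongShift.shift-arc Λ₁ Λ₁' sh₁ {a} {b} a→b))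
... | i , j , i→j , a≡i , refl with inject₁-injective a≡i
...   | refl = i→j

shift-injective : ∀ {n} (Λ₁ Λ₂ : Partition n) (Λ₁' Λ₂' : Partition (suc n)) →
                  IsShift Λ₁ Λ₁' → IsShift Λ₂ Λ₂' → Λ₁' ≈P Λ₂' → Λ₁ ≈P Λ₂
shift-injective Λ₁ Λ₂ Λ₁' Λ₂' sh₁ sh₂ eq =
  arcs-determine {Λ₁ = Λ₁} {Λ₂} (shift-arcs⊆ Λ₁ Λ₂ Λ₁' Λ₂' sh₁ sh₂ eq)
                                 (shift-arcs⊆ Λ₂ Λ₁ Λ₂' Λ₁' sh₂ sh₁ (λ i j → sym (eq i j)))

-- Shift is a bijection P ≅ Q as soon as it maps P into Q, Q consists of
-- 2-regular partitions (so that it can be unshifted), and preimages of Q lie in P.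
shift-bijection : ∀ {n} {P : Partition n → Set} {Q : Partition (suc n) → Set} →
                  (∀ Λ' → Q Λ' → TwoRegular Λ') →
                  (∀ Λ Λ' → IsShift Λ Λ' → P Λ → Q Λ') →
                  (∀ Λ Λ' → IsShift Λ Λ' → Q Λ' → P Λ) →
                  ShiftBijection n P Q
shift-bijection Q⇒two-regular forward backward = record
  { defined    = λ Λ _ → Shift.shift-exists Λ
  ; maps-into  = λ Λ Λ' p sh → forward Λ Λ' sh p
  ; injective  = λ Λ₁ Λ₂ Λ₁' Λ₂' _ _ → shift-injective Λ₁ Λ₂ Λ₁' Λ₂'
  ; surjective = λ Λ' q → let (Λ , sh) = Unshift.unshift-exists Λ' (Q⇒two-regular Λ' q)
                          in  Λ , backward Λ Λ' sh q , sh
  }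

lemma3p1 : (n : ℕ) →
    ShiftBijection n Feasible (λ Λ → TwoRegular Λ × MaxMinNonAdjacent Λ)
    × ShiftBijection n (λ Λ → Poor Λ × NonCrossing Λ) (λ Λ → TwoRegular Λ × NonCrossing Λ)
lemma3p1 n =
  shift-bijection (λ _ → proj₁)
    (λ Λ Λ' sh feasible → shift-two-regular Λ Λ' sh , shift-max-min Λ Λ' sh feasible)
    (λ Λ Λ' sh (_ , max-min) → unshift-feasible Λ Λ' sh max-min) ,
  shift-bijection (λ _ → proj₁)
    (λ Λ Λ' sh (poor , noncrossing) →
       shift-two-regular Λ Λ' sh , shift-noncrossing Λ Λ' sh poor noncrossing)
    (λ Λ Λ' sh (_ , noncrossing') →
       unshift-poor Λ Λ' sh noncrossing' , unshift-noncrossing Λ Λ' sh noncrossing')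
  where open AlongShift
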